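{- Any one-pass streaming algorithm for the $k$-Dominating Set problem on $n$-vertex graphs requires $\Omega(n^2)$ bits of space, even when $k=3$.
   Context: $k$-Dominating Set: given an undirected graph $G=(V,E)$, decide whether there is a set $S\subseteq V$ with $|S|\le k$ such that every vertex of $V\setminus S$ has at least one neighbor in $S$. Streaming model: the vertex set is fixed and the edges arrive one by one (the lower bound holds already for insertion-only streams). Lower bounds apply to all algorithms, including randomized ones that answer correctly with constant probability (say at least $2/3$). -}

module Defs where

open import Data.Nat using (ℕ; _≤_; _<_; _*_; _^_; NonZero)
open import Data.Fin using (Fin; toℕ)
open import Data.Bool using (Bool; true; false)
open import Data.List using (List; length; foldl)
open import Data.List.Membership.Propositional using (_∈_)
open import Data.List.Relation.Unary.All using (All)
open import Data.List.Relation.Unary.Any using (Any)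
open import Data.List.Relation.Unary.Unique.Propositional using (Unique)
open import Data.Product using (_×_; _,_; Σ; ∃)
open import Data.Sum using (_⊎_)
open import Relation.Binary.PropositionalEquality using (_≡_)
open import Relation.Nullary using (¬_)

-- An undirected edge on vertex set Fin n, written as an ordered pair.
Edge : ℕ → Set
Edge n = Fin n × Fin n

-- An insertion-only edge stream of a simple undirected graph on Fin n:
-- every edge (u , v) is listed with toℕ u < toℕ v (so no loops, one
-- canonical orientation), and no edge is listed twice.
record Stream (n : ℕ) : Set where
  constructor mkStream
  field
    edges    : List (Edge n)
    ordered  : All (λ e → toℕ (Data.Product.proj₁ e) < toℕ (Data.Product.proj₂ e)) edges
    distinct : Unique edges
open Stream public

Adj : ∀ {n} → Stream n → Fin n → Fin n → Set
Adj σ u v = ((u , v) ∈ edges σ) ⊎ ((v , u) ∈ edges σ)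

Dominates : ∀ {n} → Stream n → List (Fin n) → Set
Dominates {n} σ S = (v : Fin n) → ¬ (v ∈ S) → Any (λ u → Adj σ u v) S

HasDomSet : ∀ {n} → Stream n → ℕ → Set
HasDomSet σ k = Σ (List _) λ S → length S ≤ k × Dominates σ S

-- A one-pass randomized streaming algorithm on n-vertex graphs with
-- s bits of memory (2^s memory states) and a random seed drawn
-- uniformly from Fin R (public randomness, not charged to space).
record StreamAlg (n s R : ℕ) : Set where
  field
    init : Fin R → Fin (2 ^ s)
    step : Fin R → Fin (2 ^ s) → Edge n → Fin (2 ^ s)
    out  : Fin R → Fin (2 ^ s) → Bool
open StreamAlg public

run : ∀ {n s R} → StreamAlg n s R → Fin R → Stream n → Bool
run A r σ = out A r (foldl (step A r) (init A r) (edges σ))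

CorrectOn : ∀ {n s R} → StreamAlg n s R → ℕ → Stream n → Fin R → Set
CorrectOn A k σ r =
  ((run A r σ ≡ true) → HasDomSet σ k) × ((run A r σ ≡ false) → ¬ HasDomSet σ k)

-- A solves k-Dominating Set with probability ≥ 2/3: for every stream,
-- at least a 2/3 fraction of the (uniform) seeds give a correct answer.
Solves : ∀ {n s R} → StreamAlg n s R → ℕ → Set
Solves {n} {s} {R} A k =
  (σ : Stream n) → Σ (List (Fin R)) λ L →
    Unique L × (2 * R ≤ 3 * length L) × All (CorrectOn A k σ) L

-- The proof is a reduction from the one-way communication problem Index.
-- Alice holds x ∈ {0,1}^m, Bob an index k, and Bob must output x_k.
--  * Index lower bound.  Give each input x the weight 3^(agreements)
--    2^(disagreements) relative to a guess y ∈ {0,1}^m; the weights relative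
--    to a fixed y sum to 5^m.  If a deterministic protocol with s-bit messages
--    guesses 2/3 of all bits correctly, at least 1/9 of the inputs get 5/8 of
--    their bits right and hence weight ≥ 3^(5m/8) 2^(3m/8); comparing with the
--    2^s · 5^m total weight gives s ≥ m/32 - 3.  A public-coin randomized
--    protocol has, by averaging, one such good seed.
--  * Gadget.  Input positions are the pairs of a bipartite graph on two sides
--    of size w (m = w²); Alice's edges encode x, and Bob adds five vertices
--    and edges so that the graph has a dominating set of size 3 iff x_k = 1.
--    Running the streaming algorithm on Alice's edges and then Bob's turns
--    its memory state into an Index message, so s ≥ w²/32 - 3 = Ω(n²).
module Submission where

open import Defs
open import Data.Nat
open import Data.Nat.Properties
open import Data.Nat.DivMod using (_/_; _%_; m≡m%n+[m/n]*n; m%n<n; m/n*n≤m; /-monoˡ-≤)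
open import Data.Nat.Tactic.RingSolver using (solve-∀)
open import Data.Bool using (Bool; true; false)
open import Data.Bool.Properties using () renaming (_≟_ to _≟ᵇ_)
open import Data.Fin using (Fin; zero; suc; toℕ; _↑ˡ_; _↑ʳ_; remQuot; combine)
open import Data.Fin.Properties using (toℕ-↑ˡ; toℕ-↑ʳ; ↑ˡ-injective; ↑ʳ-injective; combine-remQuot; toℕ<n) renaming (_≟_ to _≟ᶠ_)
open import Data.List using (List; []; _∷_; _++_; map; length; filter; allFin; tabulate; foldl)
open import Data.List.Properties using (map-tabulate; filter-notAll; length-tabulate; length-++; length-map; foldl-++)
open import Data.List.Membership.Propositional using (_∈_; find)
open import Data.List.Membership.Propositional.Properties using (∈-allFin; ∈-map⁺; ∈-map⁻; ∈-filter⁺; ∈-filter⁻; ∈-++⁺ˡ; ∈-++⁺ʳ; ∈-++⁻)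
open import Data.List.Relation.Unary.Any using (Any; here; there)
import Data.List.Relation.Unary.Any as Any
open import Data.List.Relation.Unary.All using (All; []; _∷_)
import Data.List.Relation.Unary.All as All
import Data.List.Relation.Unary.All.Properties as AllProps
open import Data.List.Relation.Unary.AllPairs using ([]; _∷_)
open import Data.List.Relation.Unary.Unique.Propositional using (Unique)
import Data.List.Relation.Unary.Unique.Propositional.Properties as UniqueProps
open import Data.Vec using (Vec; []; _∷_; lookup)
open import Data.Product using (Σ; ∃; _×_; _,_; proj₁; proj₂)
open import Data.Sum using (_⊎_; inj₁; inj₂)
open import Data.Empty using (⊥; ⊥-elim)
open import Function using (_∘_)
open import Relation.Nullary using (¬_; Dec; yes; no; ¬?; contradiction)
open import Relation.Binary.Definitions using (DecidableEquality)
open import Relation.Binary.PropositionalEquality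
open import Algebra.Properties.CommutativeSemigroup +-commutativeSemigroup using ()
  renaming (interchange to +-interchange)
open import Algebra.Properties.CommutativeSemigroup *-commutativeSemigroup using ()
  renaming (interchange to *-interchange; x∙yz≈y∙xz to *-left-comm)

private
  variable
    A B : Set

sumL : List A → (A → ℕ) → ℕ
sumL []       f = 0
sumL (x ∷ xs) f = f x + sumL xs f

sumL-++ : ∀ (xs ys : List A) f → sumL (xs ++ ys) f ≡ sumL xs f + sumL ys f
sumL-++ []       ys f = refl
sumL-++ (x ∷ xs) ys f = trans (cong (f x +_) (sumL-++ xs ys f)) (sym (+-assoc (f x) _ _))

sumL-map : ∀ (g : A → B) xs (f : B → ℕ) → sumL (map g xs) f ≡ sumL xs (λ x → f (g x))
sumL-map g []       f = refl
sumL-map g (x ∷ xs) f = cong (f (g x) +_) (sumL-map g xs f)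

sumL-mono : ∀ (xs : List A) {f g : A → ℕ} → (∀ x → f x ≤ g x) → sumL xs f ≤ sumL xs g
sumL-mono []       f≤g = z≤n
sumL-mono (x ∷ xs) f≤g = +-mono-≤ (f≤g x) (sumL-mono xs f≤g)

sumL-cong : ∀ xs {f g : A → ℕ} → (∀ x → f x ≡ g x) → sumL xs f ≡ sumL xs g
sumL-cong []       f≡g = refl
sumL-cong (x ∷ xs) f≡g = cong₂ _+_ (f≡g x) (sumL-cong xs f≡g)

sumL-const : ∀ (xs : List A) c → sumL xs (λ _ → c) ≡ length xs * c
sumL-const []       c = refl
sumL-const (x ∷ xs) c = cong (c +_) (sumL-const xs c)

sumL-+ : ∀ xs (f g : A → ℕ) → sumL xs (λ x → f x + g x) ≡ sumL xs f + sumL xs g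
sumL-+ []       f g = refl
sumL-+ (x ∷ xs) f g = trans (cong (f x + g x +_) (sumL-+ xs f g)) (+-interchange (f x) (g x) _ _)

sumL-*ˡ : ∀ (xs : List A) c (f : A → ℕ) → sumL xs (λ x → c * f x) ≡ c * sumL xs f
sumL-*ˡ []       c f = sym (*-zeroʳ c)
sumL-*ˡ (x ∷ xs) c f = trans (cong (c * f x +_) (sumL-*ˡ xs c f)) (sym (*-distribˡ-+ c (f x) _))

sumL-swap : ∀ xs (ys : List B) (f : A → B → ℕ) →
            sumL xs (λ x → sumL ys (f x)) ≡ sumL ys (λ y → sumL xs (λ x → f x y))
sumL-swap []       ys f = sym (trans (sumL-const ys 0) (*-zeroʳ (length ys)))
sumL-swap (x ∷ xs) ys f = trans (cong (sumL ys (f x) +_) (sumL-swap xs ys f))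
                                (sym (sumL-+ ys (f x) _))

term≤sumL : ∀ {xs x} (f : A → ℕ) → x ∈ xs → f x ≤ sumL xs f
term≤sumL f (here refl)           = m≤m+n _ _
term≤sumL {xs = y ∷ ys} f (there x∈ys) = ≤-trans (term≤sumL f x∈ys) (m≤n+m _ (f y))

averaging : ∀ x xs (f : A → ℕ) c → length (x ∷ xs) * c ≤ sumL (x ∷ xs) f → ∃ λ y → c ≤ f y
averaging x xs f c h with c ≤? f x
... | yes c≤fx = x , c≤fx
averaging x []       f c h | no c≰fx = contradiction (+-cancelʳ-≤ 0 c (f x) h) c≰fx
averaging x (y ∷ ys) f c h | no c≰fx =
  averaging y ys f c (+-cancelˡ-≤ c _ _ (≤-trans h (+-monoˡ-≤ _ (<⇒≤ (≰⇒> c≰fx)))))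

sumL-allFin-suc : ∀ m (f : Fin (suc m) → ℕ) → sumL (allFin (suc m)) f ≡ f zero + sumL (allFin m) (λ k → f (suc k))
sumL-allFin-suc m f = cong (f zero +_) (trans (cong (λ l → sumL l f) (sym (map-tabulate (λ k → k) suc)))
                                              (sumL-map suc (allFin m) f))

ind : {P : Set} → Dec P → ℕ
ind (yes _) = 1
ind (no _)  = 0

ind≤1 : {P : Set} (d : Dec P) → ind d ≤ 1
ind≤1 (yes _) = s≤s z≤n
ind≤1 (no _)  = z≤n

module _ {P : A → Set} (P? : ∀ x → Dec (P x)) where

  sumL-ind : ∀ xs → sumL xs (λ x → ind (P? x)) ≡ length (filter P? xs)
  sumL-ind []       = refl
  sumL-ind (x ∷ xs) with P? x
  ... | yes _ = cong suc (sumL-ind xs)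
  ... | no  _ = sumL-ind xs

unique-⊆-length : (_≟_ : DecidableEquality A) {xs ys : List A} →
                  Unique xs → (∀ {x} → x ∈ xs → x ∈ ys) → length xs ≤ length ys
unique-⊆-length _≟_ {[]}     _           _      = z≤n
unique-⊆-length _≟_ {z ∷ xs} {ys} (z∉xs ∷ xs!) xs⊆ys =
  <-≤-trans (s≤s (unique-⊆-length _≟_ xs! xs⊆ys-z)) (filter-notAll ≢z? ys z-removed)
  where
  ≢z? : ∀ y → Dec (¬ y ≡ z)
  ≢z? y = ¬? (y ≟ z)
  xs⊆ys-z : ∀ {x} → x ∈ xs → x ∈ filter ≢z? ys
  xs⊆ys-z x∈xs = ∈-filter⁺ ≢z? (xs⊆ys (there x∈xs)) (λ x≡z → All.lookup z∉xs x∈xs (sym x≡z))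
  -- Removing z from ys makes it strictly shorter, since z ∈ ys.
  z-removed : Any (λ y → ¬ ¬ y ≡ z) ys
  z-removed = Any.map (λ z≡y y≢z → y≢z (sym z≡y)) (xs⊆ys (here refl))

length-allFin : ∀ n → length (allFin n) ≡ n
length-allFin n = length-tabulate {n = n} (λ k → k)

allVec : (m : ℕ) → List (Vec Bool m)
allVec zero    = [] ∷ []
allVec (suc m) = map (true ∷_) (allVec m) ++ map (false ∷_) (allVec m)

length-allVec : ∀ m → length (allVec m) ≡ 2 ^ m
length-allVec zero    = refl
length-allVec (suc m) = begin
  length (map (true ∷_) V ++ map (false ∷_) V)        ≡⟨ length-++ (map (true ∷_) V) ⟩
  length (map (true ∷_) V) + length (map (false ∷_) V) ≡⟨ cong₂ _+_ (length-map _ V) (length-map _ V) ⟩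
  length V + length V                                  ≡⟨ cong₂ _+_ (length-allVec m) (length-allVec m) ⟩
  2 ^ m + 2 ^ m                                        ≡⟨ cong (2 ^ m +_) (sym (+-identityʳ (2 ^ m))) ⟩
  2 ^ suc m                                            ∎
  where
  open ≡-Reasoning
  V : List (Vec Bool m)
  V = allVec m

agree : ∀ {m} → Vec Bool m → (Fin m → Bool) → ℕ
agree {m} x y = sumL (allFin m) (λ k → ind (y k ≟ᵇ lookup x k))

agree-∷ : ∀ {m} b (x : Vec Bool m) y → agree (b ∷ x) y ≡ ind (y zero ≟ᵇ b) + agree x (λ k → y (suc k))
agree-∷ {m} b x y = sumL-allFin-suc m (λ k → ind (y k ≟ᵇ lookup (b ∷ x) k))

agree≤length : ∀ {m} (x : Vec Bool m) y → agree x y ≤ m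
agree≤length {m} x y = begin
  agree x y                  ≤⟨ sumL-mono (allFin m) (λ k → ind≤1 (y k ≟ᵇ lookup x k)) ⟩
  sumL (allFin m) (λ _ → 1)  ≡⟨ sumL-const (allFin m) 1 ⟩
  length (allFin m) * 1      ≡⟨ trans (*-identityʳ _) (length-allFin m) ⟩
  m                          ∎
  where open ≤-Reasoning

weight : ∀ {m} → Vec Bool m → (Fin m → Bool) → ℕ
weight []      y = 1
weight (b ∷ x) y = (2 + ind (y zero ≟ᵇ b)) * weight x (λ k → y (suc k))

weight-sum : ∀ m (y : Fin m → Bool) → sumL (allVec m) (λ x → weight x y) ≡ 5 ^ m
weight-sum zero    y = refl
weight-sum (suc m) y = begin
  sumL (map (true ∷_) V ++ map (false ∷_) V) (λ x → weight x y)
    ≡⟨ sumL-++ (map (true ∷_) V) _ _ ⟩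
  sumL (map (true ∷_) V) (λ x → weight x y) + sumL (map (false ∷_) V) (λ x → weight x y)
    ≡⟨ cong₂ _+_ (sumL-map (true ∷_) V _) (sumL-map (false ∷_) V _) ⟩
  sumL V (λ x → wt true * weight x y′) + sumL V (λ x → wt false * weight x y′)
    ≡⟨ cong₂ _+_ (sumL-*ˡ V (wt true) _) (sumL-*ˡ V (wt false) _) ⟩
  wt true * sumL V (λ x → weight x y′) + wt false * sumL V (λ x → weight x y′)
    ≡⟨ cong₂ (λ s t → wt true * s + wt false * t) (weight-sum m y′) (weight-sum m y′) ⟩
  wt true * 5 ^ m + wt false * 5 ^ m
    ≡⟨ sym (*-distribʳ-+ (5 ^ m) (wt true) (wt false)) ⟩
  (wt true + wt false) * 5 ^ m
    ≡⟨ cong (_* 5 ^ m) (wt-sum (y zero)) ⟩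
  5 ^ suc m
    ∎
  where
  open ≡-Reasoning
  V : List (Vec Bool m)
  V = allVec m
  y′ : Fin m → Bool
  y′ k = y (suc k)
  wt : Bool → ℕ
  wt b = 2 + ind (y zero ≟ᵇ b)
  wt-sum : ∀ c → 2 + ind (c ≟ᵇ true) + (2 + ind (c ≟ᵇ false)) ≡ 5
  wt-sum true  = refl
  wt-sum false = refl

-- One position of the closed form below: a match multiplies the weight
-- by 3 and a mismatch by 2.
weight-step : ∀ {P : Set} (d : Dec P) w a m → w * 2 ^ a ≡ 3 ^ a * 2 ^ m →
              (2 + ind d) * w * 2 ^ (ind d + a) ≡ 3 ^ (ind d + a) * 2 ^ suc m
weight-step (yes _) w a m ih = begin
  3 * w * (2 * 2 ^ a)     ≡⟨ *-interchange 3 w 2 (2 ^ a) ⟩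
  6 * (w * 2 ^ a)         ≡⟨ cong (6 *_) ih ⟩
  6 * (3 ^ a * 2 ^ m)     ≡⟨ *-interchange 3 2 (3 ^ a) (2 ^ m) ⟩
  3 * 3 ^ a * (2 * 2 ^ m) ∎
  where open ≡-Reasoning
weight-step (no _) w a m ih = begin
  2 * w * 2 ^ a       ≡⟨ *-assoc 2 w (2 ^ a) ⟩
  2 * (w * 2 ^ a)     ≡⟨ cong (2 *_) ih ⟩
  2 * (3 ^ a * 2 ^ m) ≡⟨ *-left-comm 2 (3 ^ a) (2 ^ m) ⟩
  3 ^ a * (2 * 2 ^ m) ∎
  where open ≡-Reasoning

-- Closed form of the weight, weight x y = 3^a * 2^(m - a) for a = agree x y,
-- stated without truncated subtraction.
weight-agree : ∀ {m} (x : Vec Bool m) y → weight x y * 2 ^ agree x y ≡ 3 ^ agree x y * 2 ^ m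
weight-agree []              y = refl
weight-agree {suc m} (b ∷ x) y rewrite agree-∷ b x y =
  weight-step (y zero ≟ᵇ b) (weight x y′) (agree x y′) m (weight-agree x y′)
  where
  y′ : Fin m → Bool
  y′ k = y (suc k)

-- Lower bound on the weight of a vector agreeing with y on at least 5/8 of
-- its m = 8q positions.
weightFloor : ℕ → ℕ
weightFloor q = 3 ^ (5 * q) * 2 ^ (3 * q)

weight-threshold : ∀ {m} q → m ≡ 8 * q → (x : Vec Bool m) (y : Fin m → Bool) → 5 * q ≤ agree x y →
                   weightFloor q ≤ weight x y
weight-threshold {m} q m≡8q x y 5q≤a with m≤n⇒∃[o]m+o≡n 5q≤a
... | d , 5q+d≡a = *-cancelʳ-≤ (weightFloor q) (weight x y) (2 ^ a) {{m^n≢0 2 a}} (begin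
    α * β * 2 ^ a                         ≡⟨ cong (λ z → α * β * 2 ^ z) (sym 5q+d≡a) ⟩
    α * β * 2 ^ (5 * q + d)               ≡⟨ cong (α * β *_) (^-distribˡ-+-* 2 (5 * q) d) ⟩
    α * β * (γ * 2 ^ d)                   ≤⟨ *-monoʳ-≤ (α * β) (*-monoʳ-≤ γ (^-monoˡ-≤ d (≤ᵇ⇒≤ 2 3 _))) ⟩
    α * β * (γ * 3 ^ d)                   ≡⟨ rearrange α β γ (3 ^ d) ⟩
    α * 3 ^ d * (β * γ)                   ≡⟨ cong₂ _*_ (sym (^-distribˡ-+-* 3 (5 * q) d)) (sym (^-distribˡ-+-* 2 (3 * q) (5 * q))) ⟩
    3 ^ (5 * q + d) * 2 ^ (3 * q + 5 * q) ≡⟨ cong₂ (λ u v → 3 ^ u * 2 ^ v) 5q+d≡a (trans (sym (*-distribʳ-+ q 3 5)) (sym m≡8q)) ⟩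
    3 ^ a * 2 ^ m                         ≡⟨ sym (weight-agree x y) ⟩
    weight x y * 2 ^ a                    ∎)
  where
  open ≤-Reasoning
  a α β γ : ℕ
  a = agree x y
  α = 3 ^ (5 * q)
  β = 2 ^ (3 * q)
  γ = 2 ^ (5 * q)
  rearrange : ∀ a b c d → a * b * (c * d) ≡ a * d * (b * c)
  rearrange = solve-∀

totalAgreement : ∀ {m s} → (Vec Bool m → Fin (2 ^ s)) → (Fin (2 ^ s) → Fin m → Bool) → ℕ
totalAgreement {m} M D = sumL (allVec m) (λ x → agree x (D (M x)))

-- A deterministic one-way protocol for the Index problem on m = 8q bits:
-- Alice sends the s-bit message M x, after which Bob guesses every bit of x
-- by D (M x).  If these guesses are right on average in 2/3 of all positions,
-- then 2^s is large: the weight argument bounds the number of inputs on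
-- which Bob's guesses are right in 5/8 of the positions.
module DeterministicIndex (m s q : ℕ) .{{_ : NonZero q}} (m≡8q : m ≡ 8 * q)
  (M : Vec Bool m → Fin (2 ^ s)) (D : Fin (2 ^ s) → Fin m → Bool) where

  inputs : List (Vec Bool m)
  inputs = allVec m

  total : ℕ
  total = totalAgreement {m} {s} M D

  good? : ∀ x → Dec (5 * q ≤ agree x (D (M x)))
  good? x = 5 * q ≤? agree x (D (M x))

  goodCount : ℕ
  goodCount = sumL inputs (λ x → ind (good? x))

  agreement≤ : ∀ x → agree x (D (M x)) ≤ 5 * q + 3 * q * ind (good? x)
  agreement≤ x with good? x
  ... | yes _   = ≤-trans (agree≤length x (D (M x))) (≤-reflexive (trans m≡8q (eight q)))
    where
    eight : ∀ q → 8 * q ≡ 5 * q + 3 * q * 1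
    eight = solve-∀
  ... | no 5q≰a = ≤-trans (<⇒≤ (≰⇒> 5q≰a)) (m≤m+n (5 * q) _)

  total≤ : total ≤ 2 ^ m * (5 * q) + 3 * q * goodCount
  total≤ = begin
    total
      ≤⟨ sumL-mono inputs agreement≤ ⟩
    sumL inputs (λ x → 5 * q + 3 * q * ind (good? x))
      ≡⟨ sumL-+ inputs _ _ ⟩
    sumL inputs (λ _ → 5 * q) + sumL inputs (λ x → 3 * q * ind (good? x))
      ≡⟨ cong₂ _+_ (trans (sumL-const inputs _) (cong (_* (5 * q)) (length-allVec m))) (sumL-*ˡ inputs (3 * q) _) ⟩
    2 ^ m * (5 * q) + 3 * q * goodCount
      ∎
    where open ≤-Reasoning

  -- Each good input x has weight at least weightFloor q with respect to the
  -- guess D μ for its own message μ = M x, while the weights with respect to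
  -- any one guess sum to 5^m; hence few inputs are good.
  goodCount-bound : weightFloor q * goodCount ≤ 2 ^ s * 5 ^ m
  goodCount-bound = begin
    weightFloor q * goodCount
      ≡⟨ sym (sumL-*ˡ inputs (weightFloor q) _) ⟩
    sumL inputs (λ x → weightFloor q * ind (good? x))
      ≤⟨ sumL-mono inputs good⇒heavy ⟩
    sumL inputs (λ x → sumL messages (λ μ → weight x (D μ)))
      ≡⟨ sumL-swap inputs messages _ ⟩
    sumL messages (λ μ → sumL inputs (λ x → weight x (D μ)))
      ≡⟨ sumL-cong messages (λ μ → weight-sum m (D μ)) ⟩
    sumL messages (λ _ → 5 ^ m)
      ≡⟨ trans (sumL-const messages _) (cong (_* 5 ^ m) (length-allFin (2 ^ s))) ⟩
    2 ^ s * 5 ^ m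
      ∎
    where
    open ≤-Reasoning
    messages : List (Fin (2 ^ s))
    messages = allFin (2 ^ s)
    good⇒heavy : ∀ x → weightFloor q * ind (good? x) ≤ sumL messages (λ μ → weight x (D μ))
    good⇒heavy x with good? x
    ... | yes good = ≤-trans (≤-reflexive (*-identityʳ _))
                       (≤-trans (weight-threshold q m≡8q x (D (M x)) good)
                                (term≤sumL (λ μ → weight x (D μ)) (∈-allFin (M x))))
    ... | no _     = ≤-trans (≤-reflexive (*-zeroʳ (weightFloor q))) z≤n

  many-good : 2 ^ m * (2 * m) ≤ 3 * total → 2 ^ m ≤ 9 * goodCount
  many-good twoThirds = *-cancelˡ-≤ q (+-cancelˡ-≤ (15 * q * 2 ^ m) _ _ (begin
    15 * q * 2 ^ m + q * 2 ^ m                ≡⟨ sixteen (2 ^ m) q ⟩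
    2 ^ m * (2 * (8 * q))                     ≡⟨ cong (λ z → 2 ^ m * (2 * z)) (sym m≡8q) ⟩
    2 ^ m * (2 * m)                           ≤⟨ twoThirds ⟩
    3 * total                                 ≤⟨ *-monoʳ-≤ 3 total≤ ⟩
    3 * (2 ^ m * (5 * q) + 3 * q * goodCount) ≡⟨ distribute (2 ^ m) q goodCount ⟩
    15 * q * 2 ^ m + q * (9 * goodCount)      ∎))
    where
    open ≤-Reasoning
    sixteen : ∀ p q → 15 * q * p + q * p ≡ p * (2 * (8 * q))
    sixteen = solve-∀
    distribute : ∀ p q g → 3 * (p * (5 * q) + 3 * q * g) ≡ 15 * q * p + q * (9 * g)
    distribute = solve-∀

  deterministic-index-bound : 2 ^ m * (2 * m) ≤ 3 * total →
                              weightFloor q * 2 ^ m ≤ 9 * (2 ^ s * 5 ^ m)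
  deterministic-index-bound twoThirds = begin
    weightFloor q * 2 ^ m           ≤⟨ *-monoʳ-≤ (weightFloor q) (many-good twoThirds) ⟩
    weightFloor q * (9 * goodCount) ≡⟨ *-left-comm (weightFloor q) 9 goodCount ⟩
    9 * (weightFloor q * goodCount) ≤⟨ *-monoʳ-≤ 9 goodCount-bound ⟩
    9 * (2 ^ s * 5 ^ m)             ∎
    where open ≤-Reasoning

^-distribʳ-* : ∀ a b n → (a * b) ^ n ≡ a ^ n * b ^ n
^-distribʳ-* a b zero    = refl
^-distribʳ-* a b (suc n) = trans (cong (a * b *_) (^-distribʳ-* a b n)) (*-interchange a b (a ^ n) (b ^ n))

-- weightFloor q * 2^(8q) = (3^5 * 2^11)^q.
weightFloor-closed : ∀ q → weightFloor q * 2 ^ (8 * q) ≡ 497664 ^ q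
weightFloor-closed q = begin
  3 ^ (5 * q) * 2 ^ (3 * q) * 2 ^ (8 * q)     ≡⟨ cong₂ (λ u v → u * v * 2 ^ (8 * q)) (sym (^-*-assoc 3 5 q)) (sym (^-*-assoc 2 3 q)) ⟩
  (3 ^ 5) ^ q * (2 ^ 3) ^ q * 2 ^ (8 * q)     ≡⟨ cong ((3 ^ 5) ^ q * (2 ^ 3) ^ q *_) (sym (^-*-assoc 2 8 q)) ⟩
  (3 ^ 5) ^ q * (2 ^ 3) ^ q * (2 ^ 8) ^ q     ≡⟨ cong (_* (2 ^ 8) ^ q) (sym (^-distribʳ-* (3 ^ 5) (2 ^ 3) q)) ⟩
  (3 ^ 5 * 2 ^ 3) ^ q * (2 ^ 8) ^ q           ≡⟨ sym (^-distribʳ-* (3 ^ 5 * 2 ^ 3) (2 ^ 8) q) ⟩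
  497664 ^ q                                  ∎
  where open ≡-Reasoning

-- 2^u ≤ 9 * 2^s forces u ≤ s + 3, since 9 < 2^4.
exponent-bound : ∀ u s → 2 ^ u ≤ 9 * 2 ^ s → u ≤ s + 3
exponent-bound u s 2ᵘ≤9*2ˢ with u ≤? s + 3
... | yes u≤s+3 = u≤s+3
... | no  u≰s+3 = contradiction (begin-strict
  9 * 2 ^ s   <⟨ *-monoˡ-< (2 ^ s) {{m^n≢0 2 s}} (≤ᵇ⇒≤ 10 16 _) ⟩
  2 ^ 4 * 2 ^ s ≡⟨ sym (^-distribˡ-+-* 2 4 s) ⟩
  2 ^ (4 + s) ≤⟨ ^-monoʳ-≤ 2 (≤-trans (≤-reflexive (trans (+-comm 4 s) (+-suc s 3))) (≰⇒> u≰s+3)) ⟩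
  2 ^ u         ∎) (≤⇒≯ 2ᵘ≤9*2ˢ)
  where open ≤-Reasoning

-- The weight bound for m = 32u input bits yields u ≤ s + 3, because
-- (3^5 * 2^11)^4 ≥ 2 * (5^8)^4.
index-space : ∀ {m} u s → m ≡ 8 * (4 * u) → weightFloor (4 * u) * 2 ^ m ≤ 9 * (2 ^ s * 5 ^ m) → u ≤ s + 3
index-space u s refl bound = exponent-bound u s (*-cancelʳ-≤ (2 ^ u) (9 * 2 ^ s) Z {{m^n≢0 (390625 ^ 4) u}} (begin
  2 ^ u * Z                           ≡⟨ sym (^-distribʳ-* 2 (390625 ^ 4) u) ⟩
  (2 * 390625 ^ 4) ^ u                ≤⟨ ^-monoˡ-≤ u (≤ᵇ⇒≤ (2 * 390625 ^ 4) (497664 ^ 4) _) ⟩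
  (497664 ^ 4) ^ u                    ≡⟨ ^-*-assoc 497664 4 u ⟩
  497664 ^ (4 * u)                    ≡⟨ sym (weightFloor-closed (4 * u)) ⟩
  weightFloor (4 * u) * 2 ^ (8 * (4 * u)) ≤⟨ bound ⟩
  9 * (2 ^ s * 5 ^ (8 * (4 * u)))     ≡⟨ cong (λ z → 9 * (2 ^ s * z)) (sym (trans (^-*-assoc 390625 4 u) (^-*-assoc 5 8 (4 * u)))) ⟩
  9 * (2 ^ s * Z)                     ≡⟨ sym (*-assoc 9 (2 ^ s) Z) ⟩
  9 * 2 ^ s * Z                       ∎))
  where
  open ≤-Reasoning
  Z : ℕ
  Z = (390625 ^ 4) ^ u

-- A public-coin randomized one-way protocol for Index with seeds Fin (suc R):
-- on seed r Alice sends msg r x and Bob answers position k by guess r (msg r x) k,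
-- and for every input x and position k at least 2/3 of the seeds answer
-- correctly.  Averaging over seeds yields one seed whose deterministic
-- protocol is right in 2/3 of all positions.
module RandomizedIndex (m s R : ℕ)
  (msg   : Fin (suc R) → Vec Bool m → Fin (2 ^ s))
  (guess : Fin (suc R) → Fin (2 ^ s) → Fin m → Bool)
  (correct : ∀ x k → Σ (List (Fin (suc R))) λ L →
     Unique L × 2 * suc R ≤ 3 * length L × All (λ r → guess r (msg r x) k ≡ lookup x k) L) where

  seeds : List (Fin (suc R))
  seeds = allFin (suc R)

  inputs : List (Vec Bool m)
  inputs = allVec m

  positions : List (Fin m)
  positions = allFin m

  right? : ∀ r x k → Dec (guess r (msg r x) k ≡ lookup x k)
  right? r x k = guess r (msg r x) k ≟ᵇ lookup x k

  hits : Vec Bool m → Fin m → ℕ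
  hits x k = sumL seeds (λ r → ind (right? r x k))

  hits-large : ∀ x k → 2 * suc R ≤ 3 * hits x k
  hits-large x k with correct x k
  ... | L , L! , large , allRight = ≤-trans large (*-monoʳ-≤ 3 (begin
    length L                                   ≤⟨ unique-⊆-length _≟ᶠ_ L! L⊆right ⟩
    length (filter (λ r → right? r x k) seeds) ≡⟨ sym (sumL-ind (λ r → right? r x k) seeds) ⟩
    hits x k                                   ∎))
    where
    open ≤-Reasoning
    L⊆right : ∀ {r} → r ∈ L → r ∈ filter (λ r → right? r x k) seeds
    L⊆right r∈L = ∈-filter⁺ (λ r → right? r x k) (∈-allFin _) (All.lookup allRight r∈L)

  score : Fin (suc R) → ℕ
  score r = totalAgreement {m} {s} (msg r) (guess r)

  good-seed : Σ (Fin (suc R)) λ r → 2 ^ m * (2 * m) ≤ 3 * score r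
  good-seed = averaging zero (tabulate suc) (λ r → 3 * score r) (2 ^ m * (2 * m)) (begin
    length seeds * (2 ^ m * (2 * m))
      ≡⟨ cong (_* (2 ^ m * (2 * m))) (length-allFin (suc R)) ⟩
    suc R * (2 ^ m * (2 * m))
      ≡⟨ reorder (suc R) (2 ^ m) m ⟩
    2 ^ m * (m * (2 * suc R))
      ≡⟨ cong₂ (λ a b → a * (b * (2 * suc R))) (sym (length-allVec m)) (sym (length-allFin m)) ⟩
    length inputs * (length positions * (2 * suc R))
      ≡⟨ sym (trans (sumL-cong inputs (λ x → sumL-const positions _)) (sumL-const inputs _)) ⟩
    sumL inputs (λ x → sumL positions (λ k → 2 * suc R))
      ≤⟨ sumL-mono inputs (λ x → sumL-mono positions (hits-large x)) ⟩
    sumL inputs (λ x → sumL positions (λ k → 3 * hits x k))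
      ≡⟨ sumL-cong inputs (λ x → sumL-*ˡ positions 3 _) ⟩
    sumL inputs (λ x → 3 * sumL positions (hits x))
      ≡⟨ sumL-*ˡ inputs 3 _ ⟩
    3 * sumL inputs (λ x → sumL positions (hits x))
      ≡⟨ cong (3 *_) (sumL-cong inputs (λ x → sumL-swap positions seeds _)) ⟩
    3 * sumL inputs (λ x → sumL seeds (λ r → agree x (guess r (msg r x))))
      ≡⟨ cong (3 *_) (sumL-swap inputs seeds _) ⟩
    3 * sumL seeds score
      ≡⟨ sym (sumL-*ˡ seeds 3 score) ⟩
    sumL seeds (λ r → 3 * score r)
      ∎)
    where
    open ≤-Reasoning
    reorder : ∀ r p m → r * (p * (2 * m)) ≡ p * (m * (2 * r))
    reorder = solve-∀

  randomized-index-bound : ∀ u → m ≡ 8 * (4 * u) → u ≤ s + 3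
  randomized-index-bound zero    _     = z≤n
  randomized-index-bound u@(suc _) m≡32u with good-seed
  ... | r , twoThirds =
    index-space u s m≡32u (DeterministicIndex.deterministic-index-bound m s (4 * u) m≡32u (msg r) (guess r) twoThirds)

dominator : ∀ {n} {σ : Stream n} {S} → Dominates σ S → ∀ t → Σ (Fin n) λ z → z ∈ S × (z ≡ t ⊎ Adj σ z t)
dominator {S = S} dom t with t ∈? S
  where open import Data.List.Membership.DecPropositional _≟ᶠ_ using (_∈?_)
... | yes t∈S = t , t∈S , inj₁ refl
... | no  t∉S with find (dom t t∉S)
...   | z , z∈S , adj = z , z∈S , inj₂ adj

pendant-dominator : ∀ {n} {σ : Stream n} {S t t'} → Dominates σ S → (∀ {z} → Adj σ z t → z ≡ t') →
                    Σ (Fin n) λ z → z ∈ S × (z ≡ t ⊎ z ≡ t')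
pendant-dominator {σ = σ} {t = t} dom only with dominator {σ = σ} dom t
... | z , z∈S , inj₁ z≡t = z , z∈S , inj₁ z≡t
... | z , z∈S , inj₂ adj = z , z∈S , inj₂ (only adj)

no-four-distinct : DecidableEquality A → ∀ {S : List A} {z₁ z₂ z₃ z₄} → length S ≤ 3 →
  z₁ ∈ S → z₂ ∈ S → z₃ ∈ S → z₄ ∈ S →
  z₁ ≢ z₂ → z₁ ≢ z₃ → z₁ ≢ z₄ → z₂ ≢ z₃ → z₂ ≢ z₄ → z₃ ≢ z₄ → ⊥
no-four-distinct {A} _≟_ {S} {z₁} {z₂} {z₃} {z₄} |S|≤3 z₁∈S z₂∈S z₃∈S z₄∈S z₁₂ z₁₃ z₁₄ z₂₃ z₂₄ z₃₄ =
  contradiction (≤-trans (unique-⊆-length _≟_ zs-unique zs⊆S) |S|≤3) λ { (s≤s (s≤s (s≤s ()))) }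
  where
  zs : List A
  zs = z₁ ∷ z₂ ∷ z₃ ∷ z₄ ∷ []
  zs-unique : Unique zs
  zs-unique = (z₁₂ ∷ z₁₃ ∷ z₁₄ ∷ []) ∷ (z₂₃ ∷ z₂₄ ∷ []) ∷ (z₃₄ ∷ []) ∷ [] ∷ []
  zs⊆S : ∀ {z} → z ∈ zs → z ∈ S
  zs⊆S (here refl)                         = z₁∈S
  zs⊆S (there (here refl))                 = z₂∈S
  zs⊆S (there (there (here refl)))         = z₃∈S
  zs⊆S (there (there (there (here refl)))) = z₄∈S

from-disjoint-pairs : ∀ {z z' t t' u u' : A} → z ≡ t ⊎ z ≡ t' → z' ≡ u ⊎ z' ≡ u' →
  t ≢ u → t ≢ u' → t' ≢ u → t' ≢ u' → z ≢ z'
from-disjoint-pairs (inj₁ refl) (inj₁ refl) t≢u _ _ _ = t≢u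
from-disjoint-pairs (inj₁ refl) (inj₂ refl) _ t≢u' _ _ = t≢u'
from-disjoint-pairs (inj₂ refl) (inj₁ refl) _ _ t'≢u _ = t'≢u
from-disjoint-pairs (inj₂ refl) (inj₂ refl) _ _ _ t'≢u' = t'≢u'

-- Position k < m = w * w of Alice's
-- input x is the pair (a k , b k) of vertices of a complete bipartite graph
-- between two sides of size w; Alice's edges are the pairs with x_k = 1.
-- Bob adds five extra vertices h₀ … h₄ with the edges h₀a_k, h₁h₂, h₃h₄ and
-- joins h₄ to every ordinary vertex except b_k.  Then {a_k, h₂, h₄} dominates
-- if x_k = 1, while if x_k = 0 any dominating set needs a vertex from each of
-- {h₀, a_k}, {h₁, h₂}, {h₃, h₄} and a fourth one dominating b_k.
-- The e padding vertices only adjust the vertex count.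
module Gadget (w e : ℕ) where

  N : ℕ
  N = w + (w + e)

  Vertex : Set
  Vertex = Fin (5 + N)

  -- The extra vertices come first so that they are constructor terms.
  h₀ h₁ h₂ h₃ h₄ : Vertex
  h₀ = zero
  h₁ = suc zero
  h₂ = suc (suc zero)
  h₃ = suc (suc (suc zero))
  h₄ = suc (suc (suc (suc zero)))

  ordinary : Fin N → Vertex
  ordinary v = suc (suc (suc (suc (suc v))))

  ordinary-injective : ∀ {v v'} → ordinary v ≡ ordinary v' → v ≡ v'
  ordinary-injective refl = refl

  sideA sideB : Fin w → Fin N
  sideA i = i ↑ˡ (w + e)
  sideB j = w ↑ʳ (j ↑ˡ e)

  sideA<sideB : ∀ i j → toℕ (sideA i) < toℕ (sideB j)
  sideA<sideB i j rewrite toℕ-↑ˡ i (w + e) | toℕ-↑ʳ w (j ↑ˡ e) = ≤-trans (toℕ<n i) (m≤m+n w _)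

  m : ℕ
  m = w * w

  bIndex : Fin m → Fin N
  bIndex k = sideB (proj₂ (remQuot {w} w k))

  a b : Fin m → Vertex
  a k = ordinary (sideA (proj₁ (remQuot {w} w k)))
  b k = ordinary (bIndex k)

  a≢b : ∀ {j k} → a j ≢ b k
  a≢b eq = <-irrefl (cong toℕ (ordinary-injective eq)) (sideA<sideB _ _)

  pair-injective : ∀ {j k} → a j ≡ a k → b j ≡ b k → j ≡ k
  pair-injective {j} {k} aj≡ak bj≡bk =
    trans (sym (combine-remQuot {w} w j)) (trans (cong₂ combine quot≡ rem≡) (combine-remQuot {w} w k))
    where
    quot≡ : proj₁ (remQuot {w} w j) ≡ proj₁ (remQuot {w} w k)
    quot≡ = ↑ˡ-injective (w + e) _ _ (ordinary-injective aj≡ak)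
    rem≡ : proj₂ (remQuot {w} w j) ≡ proj₂ (remQuot {w} w k)
    rem≡ = ↑ˡ-injective e _ _ (↑ʳ-injective w _ _ (ordinary-injective bj≡bk))

  data AliceEdge (x : Vec Bool m) : Edge (5 + N) → Set where
    input : ∀ {j} → lookup x j ≡ true → AliceEdge x (a j , b j)

  data BobEdge (k : Fin m) : Edge (5 + N) → Set where
    anchor : BobEdge k (h₀ , a k)
    pair₁  : BobEdge k (h₁ , h₂)
    pair₂  : BobEdge k (h₃ , h₄)
    hub    : ∀ {v} → v ≢ bIndex k → BobEdge k (h₄ , ordinary v)

  GadgetEdge : Vec Bool m → Fin m → Edge (5 + N) → Set
  GadgetEdge x k ε = AliceEdge x ε ⊎ BobEdge k ε

  aliceEdges : Vec Bool m → List (Edge (5 + N))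
  aliceEdges x = map (λ j → a j , b j) (filter (λ j → lookup x j ≟ᵇ true) (allFin m))

  hubEdge : Fin N → Edge (5 + N)
  hubEdge v = h₄ , ordinary v

  notB? : ∀ k v → Dec (v ≢ bIndex k)
  notB? k v = ¬? (v ≟ᶠ bIndex k)

  hubTargets : Fin m → List (Fin N)
  hubTargets k = filter (notB? k) (allFin N)

  bobEdges : Fin m → List (Edge (5 + N))
  bobEdges k = (h₀ , a k) ∷ (h₁ , h₂) ∷ (h₃ , h₄) ∷ map hubEdge (hubTargets k)

  aliceEdges-sound : ∀ {x ε} → ε ∈ aliceEdges x → AliceEdge x ε
  aliceEdges-sound {x} ε∈ with ∈-map⁻ (λ j → a j , b j) ε∈
  ... | j , j∈ , refl = input (proj₂ (∈-filter⁻ (λ j → lookup x j ≟ᵇ true) {xs = allFin m} j∈))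

  aliceEdges-complete : ∀ {x ε} → AliceEdge x ε → ε ∈ aliceEdges x
  aliceEdges-complete {x} (input {j} xj) =
    ∈-map⁺ (λ j → a j , b j) (∈-filter⁺ (λ j → lookup x j ≟ᵇ true) (∈-allFin j) xj)

  bobEdges-sound : ∀ {k ε} → ε ∈ bobEdges k → BobEdge k ε
  bobEdges-sound (here refl)                 = anchor
  bobEdges-sound (there (here refl))         = pair₁
  bobEdges-sound (there (there (here refl))) = pair₂
  bobEdges-sound {k} (there (there (there ε∈))) with ∈-map⁻ hubEdge ε∈
  ... | v , v∈ , refl = hub (proj₂ (∈-filter⁻ (notB? k) {xs = allFin N} v∈))

  bobEdges-complete : ∀ {k ε} → BobEdge k ε → ε ∈ bobEdges k
  bobEdges-complete anchor                  = here refl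
  bobEdges-complete pair₁                   = there (here refl)
  bobEdges-complete pair₂                   = there (there (here refl))
  bobEdges-complete {k} (hub {v} v≢b) =
    there (there (there (∈-map⁺ hubEdge (∈-filter⁺ (notB? k) (∈-allFin v) v≢b))))

  alice-bob-disjoint : ∀ {x k ε} → AliceEdge x ε → BobEdge k ε → ⊥
  alice-bob-disjoint (input _) ()

  edgeList : Vec Bool m → Fin m → List (Edge (5 + N))
  edgeList x k = aliceEdges x ++ bobEdges k

  edgeList-sound : ∀ {x k ε} → ε ∈ edgeList x k → GadgetEdge x k ε
  edgeList-sound {x} ε∈ with ∈-++⁻ (aliceEdges x) ε∈
  ... | inj₁ ε∈A = inj₁ (aliceEdges-sound ε∈A)
  ... | inj₂ ε∈B = inj₂ (bobEdges-sound ε∈B)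

  edgeList-complete : ∀ {x k ε} → GadgetEdge x k ε → ε ∈ edgeList x k
  edgeList-complete (inj₁ ε) = ∈-++⁺ˡ (aliceEdges-complete ε)
  edgeList-complete {x} (inj₂ ε) = ∈-++⁺ʳ (aliceEdges x) (bobEdges-complete ε)

  increasing : ∀ {x k ε} → GadgetEdge x k ε → toℕ (proj₁ ε) < toℕ (proj₂ ε)
  increasing (inj₁ (input _))     = s≤s (s≤s (s≤s (s≤s (s≤s (sideA<sideB _ _)))))
  increasing (inj₂ anchor)        = s≤s z≤n
  increasing (inj₂ pair₁)         = s≤s (s≤s z≤n)
  increasing (inj₂ pair₂)         = s≤s (s≤s (s≤s (s≤s z≤n)))
  increasing (inj₂ (hub _))       = s≤s (s≤s (s≤s (s≤s (s≤s z≤n))))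

  edgeList-unique : ∀ x k → Unique (edgeList x k)
  edgeList-unique x k = UniqueProps.++⁺ aliceUnique bobUnique λ (ε∈A , ε∈B) →
                          alice-bob-disjoint (aliceEdges-sound {x} ε∈A) (bobEdges-sound {k} ε∈B)
    where
    aliceUnique : Unique (aliceEdges x)
    aliceUnique = UniqueProps.map⁺ (λ eq → pair-injective (cong proj₁ eq) (cong proj₂ eq))
                    (UniqueProps.filter⁺ (λ j → lookup x j ≟ᵇ true) (UniqueProps.allFin⁺ m))
    notHub : ∀ {ε} → proj₁ ε ≢ h₄ → All (λ ε' → ε ≢ ε') (map hubEdge (hubTargets k))
    notHub ≢h₄ = AllProps.map⁺ (All.universal (λ v eq → ≢h₄ (cong proj₁ eq)) (hubTargets k))
    bobUnique : Unique (bobEdges k)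
    bobUnique = ((λ ()) ∷ (λ ()) ∷ notHub (λ ()))
              ∷ ((λ ()) ∷ notHub (λ ()))
              ∷ notHub (λ ())
              ∷ UniqueProps.map⁺ (λ eq → ordinary-injective (cong proj₂ eq))
                  (UniqueProps.filter⁺ (notB? k) (UniqueProps.allFin⁺ N))

  gadget : Vec Bool m → Fin m → Stream (5 + N)
  gadget x k = mkStream (edgeList x k)
                        (All.tabulate (λ ε∈ → increasing (edgeList-sound {x} {k} ε∈)))
                        (edgeList-unique x k)

  Neighbour : Vec Bool m → Fin m → Vertex → Vertex → Set
  Neighbour x k u t = GadgetEdge x k (u , t) ⊎ GadgetEdge x k (t , u)

  adjacent : ∀ x k {u t} → Adj (gadget x k) u t → Neighbour x k u t
  adjacent x k (inj₁ ε∈) = inj₁ (edgeList-sound ε∈)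
  adjacent x k (inj₂ ε∈) = inj₂ (edgeList-sound ε∈)

  small-dominating-set : ∀ x k → lookup x k ≡ true → HasDomSet (gadget x k) 3
  small-dominating-set x k xk≡1 = (a k ∷ h₂ ∷ h₄ ∷ []) , s≤s (s≤s (s≤s z≤n)) , dominated
    where
    edge : ∀ {ε} → GadgetEdge x k ε → ε ∈ edgeList x k
    edge = edgeList-complete
    dominated : Dominates (gadget x k) (a k ∷ h₂ ∷ h₄ ∷ [])
    dominated zero                             _    = here (inj₂ (edge (inj₂ anchor)))
    dominated (suc zero)                       _    = there (here (inj₂ (edge (inj₂ pair₁))))
    dominated (suc (suc zero))                 h₂∉S = ⊥-elim (h₂∉S (there (here refl)))
    dominated (suc (suc (suc zero)))           _    = there (there (here (inj₂ (edge (inj₂ pair₂)))))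
    dominated (suc (suc (suc (suc zero))))     h₄∉S = ⊥-elim (h₄∉S (there (there (here refl))))
    dominated (suc (suc (suc (suc (suc v))))) _ with v ≟ᶠ bIndex k
    ... | yes refl = here (inj₁ (edge (inj₁ (input xk≡1))))
    ... | no  v≢b  = there (there (here (inj₁ (edge (inj₂ (hub v≢b))))))

  neighbour-h₀ : ∀ {x k u} → Neighbour x k u h₀ → u ≡ a k
  neighbour-h₀ (inj₁ (inj₁ ()))
  neighbour-h₀ (inj₁ (inj₂ ()))
  neighbour-h₀ (inj₂ (inj₁ ()))
  neighbour-h₀ (inj₂ (inj₂ anchor)) = refl

  neighbour-h₂ : ∀ {x k u} → Neighbour x k u h₂ → u ≡ h₁
  neighbour-h₂ (inj₁ (inj₁ ()))
  neighbour-h₂ (inj₁ (inj₂ pair₁)) = refl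
  neighbour-h₂ (inj₂ (inj₁ ()))
  neighbour-h₂ (inj₂ (inj₂ ()))

  neighbour-h₃ : ∀ {x k u} → Neighbour x k u h₃ → u ≡ h₄
  neighbour-h₃ (inj₁ (inj₁ ()))
  neighbour-h₃ (inj₁ (inj₂ ()))
  neighbour-h₃ (inj₂ (inj₁ ()))
  neighbour-h₃ (inj₂ (inj₂ pair₂)) = refl

  neighbour-b : ∀ {x k u t} → lookup x k ≡ false → t ≡ b k → Neighbour x k u t →
                Σ (Fin N) (λ v → u ≡ ordinary v) × u ≢ a k
  neighbour-b {x} xk≡0 t≡b (inj₁ (inj₁ (input xj≡1))) =
    (_ , refl) , λ aj≡ak → conflict (pair-injective aj≡ak t≡b) xj≡1 xk≡0
    where
    conflict : ∀ {j k} → j ≡ k → lookup x j ≡ true → lookup x k ≡ false → ⊥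
    conflict refl xk≡1 xk≡0 with trans (sym xk≡1) xk≡0
    ... | ()
  neighbour-b _ t≡b (inj₁ (inj₂ anchor))    = ⊥-elim (a≢b t≡b)
  neighbour-b _ ()  (inj₁ (inj₂ pair₁))
  neighbour-b _ ()  (inj₁ (inj₂ pair₂))
  neighbour-b _ t≡b (inj₁ (inj₂ (hub v≢b))) = ⊥-elim (v≢b (ordinary-injective t≡b))
  neighbour-b _ t≡b (inj₂ (inj₁ (input _)))  = ⊥-elim (a≢b t≡b)
  neighbour-b _ ()  (inj₂ (inj₂ anchor))
  neighbour-b _ ()  (inj₂ (inj₂ pair₁))
  neighbour-b _ ()  (inj₂ (inj₂ pair₂))
  neighbour-b _ ()  (inj₂ (inj₂ (hub _)))

  dominator-b : ∀ {x k z} → lookup x k ≡ false → z ≡ b k ⊎ Adj (gadget x k) z (b k) →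
                Σ (Fin N) (λ v → z ≡ ordinary v) × z ≢ a k
  dominator-b {k = k} _    (inj₁ refl) = (bIndex k , refl) , λ b≡a → a≢b (sym b≡a)
  dominator-b {x} {k} xk≡0 (inj₂ adj)  = neighbour-b xk≡0 refl (adjacent x k adj)

  no-small-dominating-set : ∀ x k → lookup x k ≡ false → ¬ HasDomSet (gadget x k) 3
  no-small-dominating-set x k xk≡0 (S , |S|≤3 , dom) =
    let z₁ , z₁∈S , s₁ = pendant-dominator {σ = gadget x k} dom (neighbour-h₀ ∘ adjacent x k)
        z₂ , z₂∈S , s₂ = pendant-dominator {σ = gadget x k} dom (neighbour-h₂ ∘ adjacent x k)
        z₃ , z₃∈S , s₃ = pendant-dominator {σ = gadget x k} dom (neighbour-h₃ ∘ adjacent x k)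
        z₄ , z₄∈S , c₄ = dominator {σ = gadget x k} dom (b k)
        (v , z₄≡v) , z₄≢a = dominator-b {x} {k} xk≡0 c₄
        s₄ : z₄ ≡ ordinary v ⊎ z₄ ≡ ordinary v
        s₄ = inj₁ z₄≡v
        a≢v : a k ≢ ordinary v
        a≢v a≡v = z₄≢a (trans z₄≡v (sym a≡v))
    in no-four-distinct _≟ᶠ_ |S|≤3 z₁∈S z₂∈S z₃∈S z₄∈S
         (from-disjoint-pairs s₁ s₂ (λ ()) (λ ()) (λ ()) (λ ()))
         (from-disjoint-pairs s₁ s₃ (λ ()) (λ ()) (λ ()) (λ ()))
         (from-disjoint-pairs s₁ s₄ (λ ()) (λ ()) a≢v a≢v)
         (from-disjoint-pairs s₂ s₃ (λ ()) (λ ()) (λ ()) (λ ()))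
         (from-disjoint-pairs s₂ s₄ (λ ()) (λ ()) (λ ()) (λ ()))
         (from-disjoint-pairs s₃ s₄ (λ ()) (λ ()) (λ ()) (λ ()))

correct-answer : ∀ {P : Set} (c b : Bool) → (c ≡ true → P) × (c ≡ false → ¬ P) →
                 (b ≡ true → P) → (b ≡ false → ¬ P) → c ≡ b
correct-answer true  true  _         _   _   = refl
correct-answer true  false (c⇒P , _) _   b⇒¬P = contradiction (c⇒P refl) (b⇒¬P refl)
correct-answer false true  (_ , c⇒¬P) b⇒P _  = contradiction (b⇒P refl) (c⇒¬P refl)
correct-answer false false _         _   _   = refl

-- A streaming algorithm for 3-Dominating Set yields an Index protocol: Alice
-- runs the algorithm on her edges and sends the memory state, Bob continues
-- the run on his edges; the answer is the bit x_k.
module Reduction (w e s R : ℕ) (A : StreamAlg (5 + (w + (w + e))) s (suc R)) (solves : Solves A 3) where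
  open Gadget w e

  msg : Fin (suc R) → Vec Bool m → Fin (2 ^ s)
  msg r x = foldl (step A r) (init A r) (aliceEdges x)

  guess : Fin (suc R) → Fin (2 ^ s) → Fin m → Bool
  guess r μ k = out A r (foldl (step A r) μ (bobEdges k))

  run-split : ∀ r x k → run A r (gadget x k) ≡ guess r (msg r x) k
  run-split r x k = cong (out A r) (foldl-++ (step A r) (init A r) (aliceEdges x) (bobEdges k))

  protocol-correct : ∀ x k → Σ (List (Fin (suc R))) λ L →
    Unique L × 2 * suc R ≤ 3 * length L × All (λ r → guess r (msg r x) k ≡ lookup x k) L
  protocol-correct x k with solves (gadget x k)
  ... | L , L! , large , correct = L , L! , large , All.map (λ {r} c →
          trans (sym (run-split r x k))
                (correct-answer _ (lookup x k) c (small-dominating-set x k) (no-small-dominating-set x k))) correct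

  streaming-space : ∀ u → m ≡ 8 * (4 * u) → u ≤ s + 3
  streaming-space = RandomizedIndex.randomized-index-bound m s R msg guess protocol-correct

-- Every n ≥ 64 is 5 + 16v + e with v ≥ 2 and n ≤ 64v, taking v = ⌊n/32⌋.
vertex-split : ∀ n → 64 ≤ n → Σ ℕ λ v → Σ ℕ λ e → 2 ≤ v × n ≤ 64 * v × 5 + (8 * v + (8 * v + e)) ≡ n
vertex-split n 64≤n = v , n ∸ (16 * v + 5) , 2≤v , n≤64v , trans (layout v _) (m+[n∸m]≡n 16v+5≤n)
  where
  open ≤-Reasoning
  v : ℕ
  v = n / 32
  2≤v : 2 ≤ v
  2≤v = /-monoˡ-≤ 32 64≤n
  1≤v : 1 ≤ v
  1≤v = ≤-trans (s≤s z≤n) 2≤v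
  n≤64v : n ≤ 64 * v
  n≤64v = begin
    n                  ≡⟨ m≡m%n+[m/n]*n n 32 ⟩
    n % 32 + v * 32    ≤⟨ +-monoˡ-≤ (v * 32) (<⇒≤ (m%n<n n 32)) ⟩
    32 + v * 32        ≤⟨ +-monoˡ-≤ (v * 32) (*-monoʳ-≤ 32 1≤v) ⟩
    32 * v + v * 32    ≡⟨ double v ⟩
    64 * v             ∎
    where
    double : ∀ v → 32 * v + v * 32 ≡ 64 * v
    double = solve-∀
  16v+5≤n : 16 * v + 5 ≤ n
  16v+5≤n = begin
    16 * v + 5         ≤⟨ +-monoʳ-≤ (16 * v) (≤-trans (≤ᵇ⇒≤ 5 16 _) (*-monoʳ-≤ 16 1≤v)) ⟩
    16 * v + 16 * v    ≡⟨ double v ⟩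
    v * 32             ≤⟨ m/n*n≤m n 32 ⟩
    n                  ∎
    where
    double : ∀ v → 16 * v + 16 * v ≡ v * 32
    double = solve-∀
  layout : ∀ v e → 5 + (8 * v + (8 * v + e)) ≡ 16 * v + 5 + e
  layout = solve-∀

square-bound : ∀ n v s → 2 ≤ v → n ≤ 64 * v → 2 * (v * v) ≤ s + 3 → n * n ≤ 4096 * s
square-bound n v s 2≤v n≤64v 2v²≤s+3 = begin
  n * n               ≤⟨ *-mono-≤ n≤64v n≤64v ⟩
  64 * v * (64 * v)   ≡⟨ square v ⟩
  4096 * (v * v)      ≤⟨ *-monoʳ-≤ 4096 v²≤s ⟩
  4096 * s            ∎
  where
  open ≤-Reasoning
  square : ∀ v → 64 * v * (64 * v) ≡ 4096 * (v * v)
  square = solve-∀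
  v²≤s : v * v ≤ s
  v²≤s = +-cancelʳ-≤ (v * v) (v * v) s (begin
    v * v + v * v ≡⟨ cong (v * v +_) (sym (+-identityʳ (v * v))) ⟩
    2 * (v * v)   ≤⟨ 2v²≤s+3 ⟩
    s + 3         ≤⟨ +-monoʳ-≤ s (≤-trans (n≤1+n 3) (*-mono-≤ 2≤v 2≤v)) ⟩
    s + v * v     ∎)

-- The reduction on 5 + 16v + e vertices, with Alice's sides of size w = 8v,
-- i.e. m = 64v² = 32 · 2v² input bits.
gadget-space : ∀ {n} v e s R → 5 + (8 * v + (8 * v + e)) ≡ n →
               (A : StreamAlg n s (suc R)) → Solves A 3 → 2 * (v * v) ≤ s + 3
gadget-space v e s R refl A solves = Reduction.streaming-space (8 * v) e s R A solves (2 * (v * v)) (grid v)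
  where
  grid : ∀ v → 8 * v * (8 * v) ≡ 8 * (4 * (2 * (v * v)))
  grid = solve-∀

theorem28 : Σ ℕ λ c → Σ ℕ λ n₀ → (n : ℕ) → n₀ ≤ n → (s R : ℕ) → .{{_ : NonZero R}} → (A : StreamAlg n s R) → Solves A 3 → n * n ≤ c * s
theorem28 = 4096 , 64 , space-bound
  where
  space-bound : (n : ℕ) → 64 ≤ n → (s R : ℕ) → .{{_ : NonZero R}} → (A : StreamAlg n s R) → Solves A 3 → n * n ≤ 4096 * s
  space-bound n 64≤n s zero    {{R≢0}} A solves = contradiction refl (≢-nonZero⁻¹ 0 {{R≢0}})
  space-bound n 64≤n s (suc R)         A solves =
    let v , e , 2≤v , n≤64v , n≡5+16v+e = vertex-split n 64≤n
    in  square-bound n v s 2≤v n≤64v (gadget-space v e s R n≡5+16v+e A solves)
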